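{- Let $n,m\ge 2$. Then A wins the gp achievement game on $K_n\,\square\,K_m$ if and only if both $n$ and $m$ are odd.
   Context: A general position set of a graph $G$ is a set $S\subseteq V(G)$ such that no three vertices of $S$ lie on a common shortest path of $G$. The gp achievement game on a graph: players A and B alternately select vertices, A first; a selection is legal if the vertex has not been selected before and the set of all vertices selected so far (including it) is a general position set. The game ends when no legal move exists, and the player who selected the last vertex wins; "a player wins the game" means that player has a winning strategy. The Cartesian product $G\,\square\,H$ has vertex set $V(G)\times V(H)$, with $(g_1,h_1)$ adjacent to $(g_2,h_2)$ iff either $g_1g_2\in E(G)$ and $h_1=h_2$, or $g_1=g_2$ and $h_1h_2\in E(H)$. $K_n$ is the complete graph on $n$ vertices. -}

module Defs where

open import Data.Nat using (ℕ; zero; suc; _<_)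
open import Data.Fin using (Fin)
open import Data.Product using (_×_; _,_; ∃; Σ)
open import Data.List using (List; []; _∷_)
open import Data.List.Membership.Propositional using (_∈_; _∉_)
open import Relation.Binary.PropositionalEquality using (_≡_; _≢_)
open import Relation.Nullary using (¬_)

record Graph : Set₁ where
  field
    V : Set
    E : V → V → Set
open Graph public

K : ℕ → Graph
K n = record { V = Fin n ; E = λ i j → i ≢ j }

_□_ : Graph → Graph → Graph
G □ H = record
  { V = V G × V H
  ; E = λ { (g₁ , h₁) (g₂ , h₂) →
          (E G g₁ g₂ × h₁ ≡ h₂) Data.Sum.⊎ (g₁ ≡ g₂ × E H h₁ h₂) } }
  where import Data.Sum

data Walk (G : Graph) : V G → V G → ℕ → Set where
  here : ∀ {u} → Walk G u u zero
  step : ∀ {u w v k} → E G u w → Walk G w v k → Walk G u v (suc k)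

data OnWalk (G : Graph) (x : V G) : ∀ {u v k} → Walk G u v k → Set where
  on-here : ∀ {v k} {w : Walk G x v k} → OnWalk G x w
  on-step : ∀ {u w v k} {e : E G u w} {p : Walk G w v k} →
            OnWalk G x p → OnWalk G x (step e p)

-- A shortest path (geodesic): a u,v-walk of length k with no shorter u,v-walk.
-- (A shortest walk is automatically a path.)
IsShortest : (G : Graph) → ∀ {u v k} → Walk G u v k → Set
IsShortest G {u} {v} {k} _ = ∀ k' → k' < k → ¬ Walk G u v k'

OnCommonGeodesic : (G : Graph) → V G → V G → V G → Set
OnCommonGeodesic G x y z =
  ∃ λ u → ∃ λ v → ∃ λ k → Σ (Walk G u v k) λ p →
    IsShortest G p × OnWalk G x p × OnWalk G y p × OnWalk G z p

GeneralPosition : (G : Graph) → List (V G) → Set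
GeneralPosition G S = ∀ x y z → x ∈ S → y ∈ S → z ∈ S →
  x ≢ y → y ≢ z → x ≢ z → ¬ OnCommonGeodesic G x y z

Legal : (G : Graph) → List (V G) → V G → Set
Legal G p v = v ∉ p × GeneralPosition G (v ∷ p)

-- Win G p: the player to move at position p (list of selected vertices)
-- has a winning strategy; Lose G p: the player to move at p loses
-- (every legal move leads to a position won by the opponent; in particular
-- if there is no legal move, the previous player made the last move and won).
mutual
  data Win (G : Graph) (p : List (V G)) : Set where
    win : ∀ v → Legal G p v → Lose G (v ∷ p) → Win G p

  data Lose (G : Graph) (p : List (V G)) : Set where
    lose : (∀ v → Legal G p v → Win G (v ∷ p)) → Lose G p

AWins : Graph → Set
AWins G = Win G []

-- All distances in K_n □ K_m are at most 2, so three distinct squares lie on a common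
-- geodesic exactly when they form a corner: a, b in one row and b, c in one column.
-- If n is even, B answers every move by its image under a fixed-point-free involution of
-- the rows. A symmetric position in general position has at most one square per row (a
-- square b sharing a row with a would form a corner with its mirror image), so A's move and
-- its mirror image lie in two new rows and the answer is legal; the case m even is the same
-- with columns. If n and m are odd, A takes the centre of a point reflection
-- (r, c) ↦ (σ r, τ c), where σ and τ have one fixed point each, and then mirrors B: a corner
-- through both v and its image yields, after replacing one of them by the centre or by a
-- mirror image, a corner in the position before the answer.
-- The game being finite, the mirroring player makes the last move.
module Submission where

open import Defs
open import Data.Nat using (ℕ; _≤_; _%_)
open import Data.Product using (_×_)
open import Function.Bundles using (_⇔_)
open import Relation.Binary.PropositionalEquality using (_≡_)

open import Algebra.Definitions using (Involutive)
open import Data.Empty using (⊥; ⊥-elim)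
open import Data.Fin using (Fin; toℕ; fromℕ<; opposite)
import Data.Fin.Properties as Fin
open import Data.List using (List; []; _∷_; length; cartesianProduct; allFin)
open import Data.List.Membership.DecPropositional using (_∈?_)
open import Data.List.Membership.Propositional using (_∈_; _∉_; _─_)
open import Data.List.Membership.Propositional.Properties using (∈-cartesianProduct⁺; ∈-allFin)
open import Data.List.Properties using (length-removeAt′)
open import Data.List.Relation.Binary.Subset.Propositional using (_⊆_)
open import Data.List.Relation.Unary.All using ([]; _∷_; lookup)
open import Data.List.Relation.Unary.All.Properties using (¬Any⇒All¬)
open import Data.List.Relation.Unary.AllPairs using ([]; _∷_)
open import Data.List.Relation.Unary.Any using (here; there; index)
open import Data.List.Relation.Unary.Unique.Propositional using (Unique)
open import Data.Nat using (zero; suc; _+_; _∸_; s≤s; z≤n; ⌊_/2⌋)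
open import Data.Nat.Properties
  using (≤-refl; ≤-reflexive; ≤-trans; 1+n≰n; n≤1+n; m≤n+m; m≤m+n; m≤n⇒m≤1+n; +-suc; +-identityʳ;
         suc-injective; m+[n∸m]≡n; m+n∸m≡n; n≡⌊n+n/2⌋; module ≤-Reasoning)
open import Data.Product using (_,_; proj₁; proj₂; ∃)
open import Data.Product.Properties using (≡-dec; ×-≡,≡→≡)
open import Data.Sum using (_⊎_; inj₁; inj₂)
open import Data.Unit using (⊤; tt)
open import Function using (_∘_)
open import Function.Bundles using (mk⇔)
open import Relation.Binary.Definitions using (DecidableEquality)
open import Relation.Binary.PropositionalEquality
  using (_≢_; refl; sym; trans; cong; subst; module ≡-Reasoning)
open import Relation.Nullary using (¬_; yes; no; contradiction)

module _ {A : Set} where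

  ∈-─⁺ : ∀ {x y} {ys : List A} (x∈ys : x ∈ ys) → y ∈ ys → y ≢ x → y ∈ ys ─ x∈ys
  ∈-─⁺ (here refl) (here refl) y≢x = ⊥-elim (y≢x refl)
  ∈-─⁺ (here refl) (there y∈ys) _  = y∈ys
  ∈-─⁺ (there _)   (here refl) _   = here refl
  ∈-─⁺ (there x∈ys) (there y∈ys) y≢x = there (∈-─⁺ x∈ys y∈ys y≢x)

  length-─ : ∀ {x} (ys : List A) (x∈ys : x ∈ ys) → length ys ≡ suc (length (ys ─ x∈ys))
  length-─ ys x∈ys = length-removeAt′ ys (index x∈ys)

  unique⊆⇒length≤ : ∀ {xs ys : List A} → Unique xs → xs ⊆ ys → length xs ≤ length ys
  unique⊆⇒length≤ [] _ = z≤n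
  unique⊆⇒length≤ {x ∷ xs} {ys} (x≢xs ∷ xs!) x∷xs⊆ys = begin
    suc (length xs)          ≤⟨ s≤s (unique⊆⇒length≤ xs! xs⊆ys─x) ⟩
    suc (length (ys ─ x∈ys)) ≡⟨ sym (length-─ ys x∈ys) ⟩
    length ys                ∎
    where
      open ≤-Reasoning
      x∈ys : x ∈ ys
      x∈ys = x∷xs⊆ys (here refl)
      xs⊆ys─x : xs ⊆ ys ─ x∈ys
      xs⊆ys─x y∈xs =
        ∈-─⁺ x∈ys (x∷xs⊆ys (there y∈xs)) (λ y≡x → lookup x≢xs y∈xs (sym y≡x))

  unique⊆⇒⊇ : DecidableEquality A → ∀ {xs ys : List A} →
              Unique xs → xs ⊆ ys → length ys ≤ length xs → ys ⊆ xs
  unique⊆⇒⊇ _≟_ {xs} {ys} xs! xs⊆ys ys≤xs {y} y∈ys with _∈?_ _≟_ y xs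
  ... | yes y∈xs = y∈xs
  ... | no y∉xs  = ⊥-elim (1+n≰n (begin
    suc (length xs)          ≤⟨ s≤s xs≤ys─y ⟩
    suc (length (ys ─ y∈ys)) ≡⟨ length-─ ys y∈ys ⟨
    length ys                ≤⟨ ys≤xs ⟩
    length xs                ∎))
    where
      open ≤-Reasoning
      xs≤ys─y : length xs ≤ length (ys ─ y∈ys)
      xs≤ys─y =
        unique⊆⇒length≤ xs! (λ x∈xs → ∈-─⁺ y∈ys (xs⊆ys x∈xs) (λ { refl → y∉xs x∈xs }))

  ∉⇒unique-∷ : ∀ {x} {xs : List A} → x ∉ xs → Unique xs → Unique (x ∷ xs)
  ∉⇒unique-∷ x∉xs xs! = ¬Any⇒All¬ _ x∉xs ∷ xs!

module _ {A : Set} where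

  FixedPointFree : (A → A) → Set
  FixedPointFree f = ∀ x → f x ≢ x

  IsUniqueFixedPoint : (A → A) → A → Set
  IsUniqueFixedPoint f c = f c ≡ c × (∀ x → f x ≡ x → x ≡ c)

  Symmetric : (A → A) → List A → Set
  Symmetric f S = ∀ {x} → x ∈ S → f x ∈ S

  involutive⇒injective : ∀ {f : A → A} → Involutive _≡_ f → ∀ {x y} → f x ≡ f y → x ≡ y
  involutive⇒injective {f} f-inv {x} {y} fx≡fy = begin
    x         ≡⟨ f-inv x ⟨
    f (f x)   ≡⟨ cong f fx≡fy ⟩
    f (f y)   ≡⟨ f-inv y ⟩
    y         ∎
    where open ≡-Reasoning

module _ {G : Graph} where

  Win⇒¬Lose : ∀ {p} → Win G p → ¬ Lose G p
  Win⇒¬Lose (win v legal v-loses) (lose v-wins) = Win⇒¬Lose (v-wins v legal) v-loses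

  vertices : ∀ {u v k} → Walk G u v k → List (V G)
  vertices {u} here       = u ∷ []
  vertices {u} (step _ p) = u ∷ vertices p

  onWalk⇒∈vertices : ∀ {x u v k} {p : Walk G u v k} → OnWalk G x p → x ∈ vertices p
  onWalk⇒∈vertices {p = here}     on-here   = here refl
  onWalk⇒∈vertices {p = step _ _} on-here   = here refl
  onWalk⇒∈vertices               (on-step o) = there (onWalk⇒∈vertices o)

  module Pairing (allV : List (V G)) (allV-complete : ∀ v → v ∈ allV)
                 (φ : V G → V G) (φ-involutive : Involutive _≡_ φ)
                 (P : List (V G) → Set) (P-∷ : ∀ {S v} → P S → P (v ∷ S))
                 (respond : ∀ {S v} → Symmetric φ S → P S → Legal G S v → Legal G (v ∷ S) (φ v))
                 where

    symmetric-∷ : ∀ {S v} → Symmetric φ S → Symmetric φ (φ v ∷ v ∷ S)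
    symmetric-∷ _   (here refl)          = there (here (φ-involutive _))
    symmetric-∷ _   (there (here refl))  = here refl
    symmetric-∷ S-sym (there (there x∈S)) = there (there (S-sym x∈S))

    length≤ : ∀ {S} → Unique S → length S ≤ length allV
    length≤ S! = unique⊆⇒length≤ S! (λ {x} _ → allV-complete x)

    loses-within : ∀ k {S} → length allV ≤ length S + k →
                   Unique S → Symmetric φ S → P S → Lose G S
    loses-within zero {S} bound S! _ _ = lose λ v (v∉S , _) →
      ⊥-elim (1+n≰n (≤-trans (length≤ (∉⇒unique-∷ v∉S S!))
                             (≤-trans bound (≤-reflexive (+-identityʳ _)))))
    loses-within (suc k) {S} bound S! S-sym pS = lose λ v legal@(v∉S , _) →
      let answer@(φv∉ , _) = respond S-sym pS legal in
      win (φ v) answer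
        (loses-within k (≤-trans bound (≤-trans (≤-reflexive (+-suc (length S) k)) (n≤1+n _)))
          (∉⇒unique-∷ φv∉ (∉⇒unique-∷ v∉S S!)) (symmetric-∷ S-sym) (P-∷ (P-∷ pS)))

    symmetric-loses : ∀ {S} → Unique S → Symmetric φ S → P S → Lose G S
    symmetric-loses = loses-within (length allV) (m≤n+m _ _)

  -- A symmetric position in general position meets every fibre of π at most once, and
  -- answering v by φ v keeps it so.
  module Reflection {X : Set} (π : V G → X) (φ : V G → V G) (φ-involutive : Involutive _≡_ φ)
                    (φ-moves : ∀ v → π (φ v) ≢ π v)
                    (φ-respects : ∀ {a b} → π a ≡ π b → π (φ a) ≡ π (φ b))
                    (separated⇒gp : ∀ {S} → (∀ {a b} → a ∈ S → b ∈ S → π a ≡ π b → a ≡ b) →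
                                    GeneralPosition G S)
                    (gp⇒unshared : ∀ {S x y} → GeneralPosition G S → x ∈ S → y ∈ S → φ y ∈ S →
                                   π x ≡ π y → x ≡ y)
                    where

    respond : ∀ {S v} → Symmetric φ S → Legal G S v → Legal G (v ∷ S) (φ v)
    respond {S} {v} S-sym (v∉S , gp) = φv∉ , separated⇒gp separated
      where
        unshared : ∀ {a b} → a ∈ v ∷ S → b ∈ S → π a ≡ π b → a ≡ b
        unshared a∈ b∈S = gp⇒unshared gp a∈ (there b∈S) (there (S-sym b∈S))

        φv-unshared : ∀ {b} → b ∈ v ∷ S → π (φ v) ≡ π b → φ v ≡ b
        φv-unshared (here refl) e = ⊥-elim (φ-moves v e)
        φv-unshared {b} (there b∈S) e = begin
          φ v         ≡⟨ cong φ (unshared (here refl) (S-sym b∈S) πv≡πφb) ⟩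
          φ (φ b)     ≡⟨ φ-involutive b ⟩
          b           ∎
          where
            open ≡-Reasoning
            πv≡πφb : π v ≡ π (φ b)
            πv≡πφb = subst (λ w → π w ≡ π (φ b)) (φ-involutive v) (φ-respects e)

        separated : ∀ {a b} → a ∈ φ v ∷ v ∷ S → b ∈ φ v ∷ v ∷ S → π a ≡ π b → a ≡ b
        separated (here refl)         (here refl)         _ = refl
        separated (here refl)         (there b∈)          e = φv-unshared b∈ e
        separated (there a∈)          (here refl)         e = sym (φv-unshared a∈ (sym e))
        separated (there (here refl)) (there (here refl)) _ = refl
        separated (there a∈)          (there (there b∈S)) e = unshared a∈ b∈S e
        separated (there (there a∈S)) (there (here refl)) e = sym (unshared (here refl) a∈S (sym e))

        φv∉ : φ v ∉ v ∷ S
        φv∉ (here φv≡v)   = φ-moves v (cong π φv≡v)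
        φv∉ (there φv∈S) = v∉S (subst (_∈ S) (φ-involutive v) (S-sym φv∈S))

module Rook (n m : ℕ) where

  Square : Set
  Square = Fin n × Fin m

  Rook : Graph
  Rook = K n □ K m

  allSquares : List Square
  allSquares = cartesianProduct (allFin n) (allFin m)

  ∈-allSquares : ∀ a → a ∈ allSquares
  ∈-allSquares (r , c) = ∈-cartesianProduct⁺ (∈-allFin r) (∈-allFin c)

  _≟ˢ_ : DecidableEquality Square
  _≟ˢ_ = ≡-dec Fin._≟_ Fin._≟_

  ≡,≡⇒≡ : ∀ {a b : Square} → proj₁ a ≡ proj₁ b → proj₂ a ≡ proj₂ b → a ≡ b
  ≡,≡⇒≡ r c = ×-≡,≡→≡ (r , c)

  -- The two kinds of edges of K n □ K m: E Rook a b is ColumnMates a b ⊎ RowMates a b.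
  RowMates ColumnMates : Square → Square → Set
  RowMates a b = proj₁ a ≡ proj₁ b × proj₂ a ≢ proj₂ b
  ColumnMates a b = proj₁ a ≢ proj₁ b × proj₂ a ≡ proj₂ b

  rowMates-sym : ∀ {a b} → RowMates a b → RowMates b a
  rowMates-sym (r , c) = sym r , λ e → c (sym e)

  columnMates-sym : ∀ {a b} → ColumnMates a b → ColumnMates b a
  columnMates-sym (r , c) = (λ e → r (sym e)) , sym c

  Corner : Square → Square → Square → Set
  Corner a b c = RowMates a b × ColumnMates b c

  NoCorner : List Square → Set
  NoCorner S = ∀ {a b c} → a ∈ S → b ∈ S → c ∈ S → ¬ Corner a b c

  Far : Square → Square → Set
  Far a c = proj₁ a ≢ proj₁ c × proj₂ a ≢ proj₂ c

  corner⇒far : ∀ {a b c} → Corner a b c → Far a c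
  corner⇒far ((r , c≢) , (r≢ , c)) = (λ e → r≢ (trans (sym r) e)) , (λ e → c≢ (trans e (sym c)))

  sameRow⇒near : ∀ {a b} → proj₁ a ≡ proj₁ b → ∃ λ k → k ≤ 1 × Walk Rook a b k
  sameRow⇒near {a} {b} r with proj₂ a Fin.≟ proj₂ b
  ... | yes c = 0 , z≤n , subst (λ b → Walk Rook a b 0) (≡,≡⇒≡ r c) here
  ... | no c≢ = 1 , ≤-refl , step (inj₂ (r , c≢)) here

  sameColumn⇒near : ∀ {a b} → proj₂ a ≡ proj₂ b → ∃ λ k → k ≤ 1 × Walk Rook a b k
  sameColumn⇒near {a} {b} c with proj₁ a Fin.≟ proj₁ b
  ... | yes r = 0 , z≤n , subst (λ b → Walk Rook a b 0) (≡,≡⇒≡ r c) here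
  ... | no r≢ = 1 , ≤-refl , step (inj₁ (r≢ , c)) here

  walk≤2 : ∀ a b → ∃ λ k → k ≤ 2 × Walk Rook a b k
  walk≤2 a b with proj₁ a Fin.≟ proj₁ b | proj₂ a Fin.≟ proj₂ b
  ... | yes r | _     = let k , k≤1 , w = sameRow⇒near r in k , m≤n⇒m≤1+n k≤1 , w
  ... | no _  | yes c = let k , k≤1 , w = sameColumn⇒near c in k , m≤n⇒m≤1+n k≤1 , w
  ... | no r≢ | no c≢ = 2 , ≤-refl , step (inj₁ (r≢ , refl)) (step (inj₂ (refl , c≢)) here)

  far⇒shortest : ∀ {a c} → Far a c → (p : Walk Rook a c 2) → IsShortest Rook p
  far⇒shortest (r≢ , _) _ 0 _ here                        = r≢ refl
  far⇒shortest (_ , c≢) _ 1 _ (step (inj₁ (_ , c)) here) = c≢ c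
  far⇒shortest (r≢ , _) _ 1 _ (step (inj₂ (r , _)) here) = r≢ r
  far⇒shortest _        _ (suc (suc _)) (s≤s (s≤s ())) _

  shortest⇒far : ∀ {a c} (p : Walk Rook a c 2) → IsShortest Rook p → Far a c
  shortest⇒far _ shortest =
    (λ r → let k , k≤1 , w = sameRow⇒near r in shortest k (s≤s k≤1) w) ,
    (λ c → let k , k≤1 , w = sameColumn⇒near c in shortest k (s≤s k≤1) w)

  two-step⇒corner : ∀ {a b c} → E Rook a b → E Rook b c → Far a c → Corner a b c ⊎ Corner c b a
  two-step⇒corner (inj₁ (_ , c₁)) (inj₁ (_ , c₂)) (_ , c≢) = ⊥-elim (c≢ (trans c₁ c₂))
  two-step⇒corner (inj₂ ab)       (inj₁ bc)       _        = inj₁ (ab , bc)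
  two-step⇒corner (inj₁ ab)       (inj₂ bc)       _        = inj₂ (rowMates-sym bc , columnMates-sym ab)
  two-step⇒corner (inj₂ (r₁ , _)) (inj₂ (r₂ , _)) (r≢ , _) = ⊥-elim (r≢ (trans r₁ r₂))

  gp⇒noCorner : ∀ {S} → GeneralPosition Rook S → NoCorner S
  gp⇒noCorner gp {a} {b} {c} a∈ b∈ c∈ k@(ab , bc) =
    gp a b c a∈ b∈ c∈
      (λ e → proj₂ ab (cong proj₂ e)) (λ e → proj₁ bc (cong proj₁ e)) (λ e → proj₁ far (cong proj₁ e))
      (a , c , 2 , p , far⇒shortest far p , on-here , on-step on-here , on-step (on-step on-here))
    where
      far : Far a c
      far = corner⇒far k
      p : Walk Rook a c 2
      p = step (inj₂ ab) (step (inj₁ bc) here)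

  noCorner⇒gp : ∀ {S} → NoCorner S → GeneralPosition Rook S
  noCorner⇒gp {S} nc x y z x∈ y∈ z∈ x≢y y≢z x≢z (_ , _ , _ , p , p-shortest , x∈p , y∈p , z∈p) =
    no-geodesic p p-shortest
      (lookup (onWalk⇒∈vertices x∈p ∷ onWalk⇒∈vertices y∈p ∷ onWalk⇒∈vertices z∈p ∷ []))
    where
      xyz : List Square
      xyz = x ∷ y ∷ z ∷ []

      xyz! : Unique xyz
      xyz! = (x≢y ∷ x≢z ∷ []) ∷ (y≢z ∷ []) ∷ [] ∷ []

      xyz⊆S : xyz ⊆ S
      xyz⊆S = lookup (x∈ ∷ y∈ ∷ z∈ ∷ [])

      no-geodesic : ∀ {u v k} (p : Walk Rook u v k) → IsShortest Rook p → xyz ⊆ vertices p → ⊥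
      no-geodesic here          _ xyz⊆p = contradiction (unique⊆⇒length≤ xyz! xyz⊆p) λ { (s≤s ()) }
      no-geodesic (step _ here) _ xyz⊆p =
        contradiction (unique⊆⇒length≤ xyz! xyz⊆p) λ { (s≤s (s≤s ())) }
      no-geodesic p@(step e₁ (step e₂ here)) shortest xyz⊆p =
        corner-in-S (p⊆S (here refl)) (p⊆S (there (here refl))) (p⊆S (there (there (here refl))))
          (two-step⇒corner e₁ e₂ (shortest⇒far p shortest))
        where
          p⊆S : vertices p ⊆ S
          p⊆S a∈p = xyz⊆S (unique⊆⇒⊇ _≟ˢ_ xyz! xyz⊆p ≤-refl a∈p)
          corner-in-S : ∀ {a b c} → a ∈ S → b ∈ S → c ∈ S → Corner a b c ⊎ Corner c b a → ⊥
          corner-in-S a∈ b∈ c∈ (inj₁ k) = nc a∈ b∈ c∈ k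
          corner-in-S a∈ b∈ c∈ (inj₂ k) = nc c∈ b∈ a∈ k
      no-geodesic {u} {v} {suc (suc (suc k))} (step _ (step _ (step _ _))) shortest _ =
        let (j , j≤2 , w) = walk≤2 u v in shortest j (s≤s (≤-trans j≤2 (m≤m+n 2 k))) w

  module RowReflection (σ : Fin n → Fin n) (σ-involutive : Involutive _≡_ σ)
                       (σ-free : FixedPointFree σ) where

    φ : Square → Square
    φ a = σ (proj₁ a) , proj₂ a

    φ-involutive : Involutive _≡_ φ
    φ-involutive a = cong (_, proj₂ a) (σ-involutive (proj₁ a))

    rowSeparated⇒gp : ∀ {S} → (∀ {a b} → a ∈ S → b ∈ S → proj₁ a ≡ proj₁ b → a ≡ b) →
                      GeneralPosition Rook S
    rowSeparated⇒gp separated =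
      noCorner⇒gp λ a∈ b∈ _ ((r , c≢) , _) → c≢ (cong proj₂ (separated a∈ b∈ r))

    gp⇒rowUnshared : ∀ {S x y} → GeneralPosition Rook S → x ∈ S → y ∈ S → φ y ∈ S →
                     proj₁ x ≡ proj₁ y → x ≡ y
    gp⇒rowUnshared {x = x} {y} gp x∈ y∈ φy∈ r with proj₂ x Fin.≟ proj₂ y
    ... | yes c = ≡,≡⇒≡ r c
    ... | no c≢ = ⊥-elim (gp⇒noCorner gp x∈ y∈ φy∈ ((r , c≢) , (λ e → σ-free _ (sym e)) , refl))

    open Reflection proj₁ φ φ-involutive (σ-free ∘ proj₁) (cong σ) rowSeparated⇒gp gp⇒rowUnshared

    second-player-wins : Lose Rook []
    second-player-wins =
      Pairing.symmetric-loses allSquares ∈-allSquares φ φ-involutive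
        (λ _ → ⊤) _ (λ S-sym _ → respond S-sym) [] (λ ()) tt

  module ColumnReflection (τ : Fin m → Fin m) (τ-involutive : Involutive _≡_ τ)
                          (τ-free : FixedPointFree τ) where

    φ : Square → Square
    φ a = proj₁ a , τ (proj₂ a)

    φ-involutive : Involutive _≡_ φ
    φ-involutive a = cong (proj₁ a ,_) (τ-involutive (proj₂ a))

    columnSeparated⇒gp : ∀ {S} → (∀ {a b} → a ∈ S → b ∈ S → proj₂ a ≡ proj₂ b → a ≡ b) →
                         GeneralPosition Rook S
    columnSeparated⇒gp separated =
      noCorner⇒gp λ _ b∈ c∈ (_ , (r≢ , c)) → r≢ (cong proj₁ (separated b∈ c∈ c))

    gp⇒columnUnshared : ∀ {S x y} → GeneralPosition Rook S → x ∈ S → y ∈ S → φ y ∈ S →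
                        proj₂ x ≡ proj₂ y → x ≡ y
    gp⇒columnUnshared {x = x} {y} gp x∈ y∈ φy∈ c with proj₁ x Fin.≟ proj₁ y
    ... | yes r = ≡,≡⇒≡ r c
    ... | no r≢ = ⊥-elim (gp⇒noCorner gp φy∈ y∈ x∈ ((refl , τ-free _) , (λ e → r≢ (sym e)) , sym c))

    open Reflection proj₂ φ φ-involutive (τ-free ∘ proj₂) (cong τ)
                    columnSeparated⇒gp gp⇒columnUnshared

    second-player-wins : Lose Rook []
    second-player-wins =
      Pairing.symmetric-loses allSquares ∈-allSquares φ φ-involutive
        (λ _ → ⊤) _ (λ S-sym _ → respond S-sym) [] (λ ()) tt

  module CentralReflection (σ : Fin n → Fin n) (σ-involutive : Involutive _≡_ σ)
                           (r₀ : Fin n) (r₀-unique : IsUniqueFixedPoint σ r₀)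
                           (τ : Fin m → Fin m) (τ-involutive : Involutive _≡_ τ)
                           (c₀ : Fin m) (c₀-unique : IsUniqueFixedPoint τ c₀) where

    φ : Square → Square
    φ a = σ (proj₁ a) , τ (proj₂ a)

    centre : Square
    centre = r₀ , c₀

    φ-involutive : Involutive _≡_ φ
    φ-involutive a = ≡,≡⇒≡ (σ-involutive (proj₁ a)) (τ-involutive (proj₂ a))

    φ-fixed⇒centre : ∀ {a} → φ a ≡ a → a ≡ centre
    φ-fixed⇒centre e = ≡,≡⇒≡ (proj₂ r₀-unique _ (cong proj₁ e)) (proj₂ c₀-unique _ (cong proj₂ e))

    corner-φ : ∀ {a b c} → Corner a b c → Corner (φ a) (φ b) (φ c)
    corner-φ ((r , c≢) , (r≢ , c)) =
      (cong σ r , λ e → c≢ (involutive⇒injective τ-involutive e)) ,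
      ((λ e → r≢ (involutive⇒injective σ-involutive e)) , cong τ c)

    centre-rowMates : ∀ {a} → RowMates (φ a) a → RowMates centre a
    centre-rowMates (r , c≢) =
      sym (proj₂ r₀-unique _ r) , λ c₀≡ → c≢ (trans (cong τ (sym c₀≡)) (trans (proj₁ c₀-unique) c₀≡))

    centre-columnMates : ∀ {a} → ColumnMates a (φ a) → ColumnMates a centre
    centre-columnMates (r≢ , c) =
      (λ r≡ → r≢ (trans r≡ (trans (sym (proj₁ r₀-unique)) (cong σ (sym r≡))))) , proj₂ c₀-unique _ (sym c)

    corner-a-b-φa : ∀ {a b} → Corner a b (φ a) → Corner b a (φ b)
    corner-a-b-φa {a} ((r , c≢) , (r≢ , c)) =
      rowMates-sym (r , c≢) ,
      ((λ e → r≢ (trans (sym r) (trans e (cong σ (sym r))))) ,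
       trans (sym (τ-involutive (proj₂ a))) (cong τ (sym c)))

    corner-φa-b-a : ∀ {a b} → Corner (φ a) b a → Corner (φ b) a b
    corner-φa-b-a {a} ((r , c≢) , (r≢ , c)) =
      (trans (cong σ (sym r)) (σ-involutive (proj₁ a)) ,
       λ e → c≢ (trans (cong τ (sym c)) (trans e (sym c)))) ,
      columnMates-sym (r≢ , c)

    module Answer {S v} (S-sym : Symmetric φ S) (centre∈S : centre ∈ S) (nc : NoCorner (v ∷ S)) where

      T : List Square
      T = φ v ∷ v ∷ S

      centre∈ : centre ∈ v ∷ S
      centre∈ = there centre∈S

      v∈ : v ∈ v ∷ S
      v∈ = here refl

      φ-∈ : ∀ {x} → x ∈ φ v ∷ S → φ x ∈ v ∷ S
      φ-∈ (here refl)  = here (φ-involutive v)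
      φ-∈ (there x∈S) = there (S-sym x∈S)

      φ-∈T : ∀ {x} → x ∈ T → φ x ∈ T
      φ-∈T (here refl)          = there (here (φ-involutive v))
      φ-∈T (there (here refl))  = here refl
      φ-∈T (there (there x∈S)) = there (there (S-sym x∈S))

      nc-φ : NoCorner (φ v ∷ S)
      nc-φ a∈ b∈ c∈ k = nc (φ-∈ a∈) (φ-∈ b∈) (φ-∈ c∈) (corner-φ k)

      middle-v : ∀ {a c} → a ∈ T → c ∈ T → ¬ Corner a v c
      middle-v (here refl) (here refl) k         = proj₁ (corner⇒far k) refl
      middle-v (here refl) (there c∈) (ab , bc) = nc centre∈ v∈ c∈ (centre-rowMates ab , bc)
      middle-v (there a∈) (here refl) (ab , bc) = nc a∈ v∈ centre∈ (ab , centre-columnMates bc)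
      middle-v (there a∈) (there c∈) k          = nc a∈ v∈ c∈ k

      middle-S : ∀ {a b c} → b ∈ S → a ∈ T → c ∈ T → ¬ Corner a b c
      middle-S b∈ (here refl)         (here refl)         k = proj₁ (corner⇒far k) refl
      middle-S b∈ (here refl)         (there (here refl)) k =
        nc (there (S-sym b∈)) v∈ (there b∈) (corner-φa-b-a k)
      middle-S b∈ (here refl)         (there (there c∈))  k = nc-φ (here refl) (there b∈) (there c∈) k
      middle-S b∈ (there (here refl)) (here refl)         k =
        nc (there b∈) v∈ (there (S-sym b∈)) (corner-a-b-φa k)
      middle-S b∈ (there (there a∈))  (here refl)         k = nc-φ (there a∈) (there b∈) (here refl) k
      middle-S b∈ (there a∈)          (there c∈)          k = nc a∈ (there b∈) c∈ k

      noCorner : NoCorner T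
      noCorner a∈ (here refl)          c∈ k =
        middle-v (φ-∈T a∈) (φ-∈T c∈) (subst (λ b → Corner _ b _) (φ-involutive v) (corner-φ k))
      noCorner a∈ (there (here refl))  c∈ k = middle-v a∈ c∈ k
      noCorner a∈ (there (there b∈S)) c∈ k = middle-S b∈S a∈ c∈ k

    respond : ∀ {S v} → Symmetric φ S → centre ∈ S → Legal Rook S v → Legal Rook (v ∷ S) (φ v)
    respond {S} {v} S-sym centre∈S (v∉S , gp) =
      φv∉ , noCorner⇒gp (Answer.noCorner S-sym centre∈S (gp⇒noCorner gp))
      where
        φv∉ : φ v ∉ v ∷ S
        φv∉ (here φv≡v)   = v∉S (subst (_∈ S) (sym (φ-fixed⇒centre φv≡v)) centre∈S)
        φv∉ (there φv∈S) = v∉S (subst (_∈ S) (φ-involutive v) (S-sym φv∈S))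

    first-player-wins : Win Rook []
    first-player-wins =
      win centre ((λ ()) , noCorner⇒gp λ { (here refl) (here refl) _ ((_ , c≢) , _) → c≢ refl })
      (Pairing.symmetric-loses allSquares ∈-allSquares φ φ-involutive (centre ∈_) there respond
        ([] ∷ []) (λ { (here refl) → here (≡,≡⇒≡ (proj₁ r₀-unique) (proj₁ c₀-unique)) }) (here refl))

%2-dichotomy : ∀ n → n % 2 ≡ 0 ⊎ n % 2 ≡ 1
%2-dichotomy 0             = inj₁ refl
%2-dichotomy 1             = inj₂ refl
%2-dichotomy (suc (suc n)) = %2-dichotomy n

[1+t+t]%2≡1 : ∀ t → suc (t + t) % 2 ≡ 1
[1+t+t]%2≡1 zero    = refl
[1+t+t]%2≡1 (suc t) = trans (cong (λ k → suc (suc k) % 2) (+-suc t t)) ([1+t+t]%2≡1 t)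

%2≡1⇒1+t+t : ∀ n → n % 2 ≡ 1 → ∃ λ t → suc (t + t) ≡ n
%2≡1⇒1+t+t 1 _             = 0 , refl
%2≡1⇒1+t+t (suc (suc n)) odd with %2≡1⇒1+t+t n odd
... | t , 1+t+t≡n = suc t , cong (suc ∘ suc) (trans (+-suc t t) 1+t+t≡n)

t+t-injective : ∀ {s t} → s + s ≡ t + t → s ≡ t
t+t-injective {s} {t} e = trans (n≡⌊n+n/2⌋ s) (trans (cong ⌊_/2⌋ e) (sym (n≡⌊n+n/2⌋ t)))

opposite-fixed⇒ : ∀ {n} (i : Fin n) → opposite i ≡ i → suc (toℕ i + toℕ i) ≡ n
opposite-fixed⇒ {n} i fixed = begin
  suc (toℕ i + toℕ i)            ≡⟨ cong (λ k → suc (toℕ i + k)) i≡ ⟩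
  suc (toℕ i + (n ∸ suc (toℕ i))) ≡⟨ m+[n∸m]≡n (Fin.toℕ<n i) ⟩
  n                               ∎
  where
    open ≡-Reasoning
    i≡ : toℕ i ≡ n ∸ suc (toℕ i)
    i≡ = trans (cong toℕ (sym fixed)) (Fin.opposite-prop i)

⇒opposite-fixed : ∀ {n} (i : Fin n) → suc (toℕ i + toℕ i) ≡ n → opposite i ≡ i
⇒opposite-fixed {n} i 1+i+i≡n = Fin.toℕ-injective (begin
  toℕ (opposite i)               ≡⟨ Fin.opposite-prop i ⟩
  n ∸ suc (toℕ i)                ≡⟨ cong (_∸ suc (toℕ i)) 1+i+i≡n ⟨
  (toℕ i + toℕ i) ∸ toℕ i         ≡⟨ m+n∸m≡n (toℕ i) (toℕ i) ⟩
  toℕ i                          ∎)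
  where open ≡-Reasoning

even⇒opposite-fixedPointFree : ∀ {n} → n % 2 ≡ 0 → FixedPointFree (opposite {n})
even⇒opposite-fixedPointFree even i fixed =
  1≢0 (trans (sym ([1+t+t]%2≡1 (toℕ i))) (trans (cong (_% 2) (opposite-fixed⇒ i fixed)) even))
  where
    1≢0 : 1 ≢ 0
    1≢0 ()

odd⇒opposite-centre : ∀ {n} → n % 2 ≡ 1 → ∃ λ c → IsUniqueFixedPoint (opposite {n}) c
odd⇒opposite-centre {n} odd with %2≡1⇒1+t+t n odd
... | t , refl = c , ⇒opposite-fixed c (cong (λ k → suc (k + k)) toℕc≡t) , unique
  where
    c : Fin (suc (t + t))
    c = fromℕ< (s≤s (m≤m+n t t))
    toℕc≡t : toℕ c ≡ t
    toℕc≡t = Fin.toℕ-fromℕ< _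
    unique : ∀ i → opposite i ≡ i → i ≡ c
    unique i fixed = Fin.toℕ-injective
      (trans (t+t-injective (suc-injective (opposite-fixed⇒ i fixed))) (sym toℕc≡t))

theorem3p6 : (n m : ℕ) → 2 ≤ n → 2 ≤ m →
    AWins (K n □ K m) ⇔ ((n % 2 ≡ 1) × (m % 2 ≡ 1))
theorem3p6 n m _ _ = mk⇔ A-wins⇒odd odd⇒A-wins
  where
    open Rook n m

    A-wins⇒odd : AWins Rook → (n % 2 ≡ 1) × (m % 2 ≡ 1)
    A-wins⇒odd A-wins with %2-dichotomy n | %2-dichotomy m
    ... | inj₂ n-odd  | inj₂ m-odd  = n-odd , m-odd
    ... | inj₁ n-even | _           = ⊥-elim (Win⇒¬Lose A-wins
      (RowReflection.second-player-wins opposite Fin.opposite-involutive (even⇒opposite-fixedPointFree n-even)))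
    ... | inj₂ _      | inj₁ m-even = ⊥-elim (Win⇒¬Lose A-wins
      (ColumnReflection.second-player-wins opposite Fin.opposite-involutive (even⇒opposite-fixedPointFree m-even)))

    odd⇒A-wins : (n % 2 ≡ 1) × (m % 2 ≡ 1) → AWins Rook
    odd⇒A-wins (n-odd , m-odd) =
      let r₀ , r₀-unique = odd⇒opposite-centre n-odd
          c₀ , c₀-unique = odd⇒opposite-centre m-odd
      in CentralReflection.first-player-wins
           opposite Fin.opposite-involutive r₀ r₀-unique opposite Fin.opposite-involutive c₀ c₀-unique
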